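{- Let $G$ be a cograph of order $n$ with cotree $T_G$ having $r$ interior vertices $w_1,\dots,w_r$, and let $t_i\ge 0$ be the number of leaf children of $w_i$, all leaves having weight $p=1$. For every $j\in\{1,\dots,r\}$, $$\delta(w_j)=\begin{cases} t_j+\sum_{i} t_i, & \text{if } w_j \text{ is of } \otimes\text{ -type},\\ \sum_i t_i, & \text{if } w_j \text{ is of } \cup\text{ -type},\end{cases}$$ where in both cases the sum is over the indices $i\neq j$ with $lca(w_i,w_j)$ of $\otimes$-type. Furthermore, for every $j\in\{1,\dots,r\}$, $$n=\delta(w_j)+\delta(\overline{w_j}),$$ where $\overline{w_j}$ is the interior vertex corresponding to $w_j$ (with the opposite type) in the cotree $T_{\overline{G}}$ of the complement $\overline{G}$.
   Context: A cograph is a graph with no induced path on four vertices. The cotree $T_G$ of a cograph $G$ is the rooted tree whose leaves are the vertices of $G$, whose interior vertices are each labelled $\cup$ or $\otimes$, every interior vertex having at least two children, with labels alternating along root-to-leaf paths, and such that two vertices of $G$ are adjacent iff their least common ancestor is of $\otimes$-type. The cotree $T_{\overline{G}}$ of the complement $\overline{G}$ is obtained from $T_G$ by switching the type of every interior vertex and keeping the leaves. For interior vertices, $lca(w_i,w_j)$ is their least common ancestor, with $lca(w_j,w_j)=w_j$. If each leaf $v$ has a weight $p(v)$, the degree of an interior vertex $w_j$ is $\delta(w_j)=\sum p(v)$, the sum over all leaves $v$ whose parent $w_i$ satisfies that $lca(w_i,w_j)$ is of $\otimes$-type. -}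

module Defs where

open import Data.Nat using (ℕ; zero; suc; _+_; _*_; _≤_)
open import Data.Fin using (Fin)
import Data.Fin.Properties as FinP
open import Data.List using (List; []; _∷_; map; concatMap; _++_)
open import Data.Nat.ListAction using (sum)
open import Data.List using () renaming (allFin to allFinL)
open import Data.Product using (_×_; _,_)
open import Data.Unit using (⊤)
open import Data.Empty using (⊥)
open import Relation.Binary.PropositionalEquality using (_≡_; refl)
open import Relation.Nullary using (Dec; yes; no; ¬_)

-- Type of an interior vertex of a cotree: ∪ (union) or ⊗ (join).
data Ty : Set where
  ∪ty ⊗ty : Ty

swapTy : Ty → Ty
swapTy ∪ty = ⊗ty
swapTy ⊗ty = ∪ty

data Cotree : Set where
  leaf : Cotree
  node : Ty → (k : ℕ) → (Fin k → Cotree) → Cotree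

AltChild : Ty → Cotree → Set
AltChild t leaf = ⊤
AltChild t (node t' k f) = t' ≡ swapTy t

WF : Cotree → Set
WF leaf = ⊤
WF (node t k f) = (2 ≤ k) × ((i : Fin k) → WF (f i) × AltChild t (f i))

IsLeaf : Cotree → Set
IsLeaf leaf = ⊤
IsLeaf (node _ _ _) = ⊥

-- Interior vertices of a tree (positions of interior nodes).
data Pos : Cotree → Set where
  here  : ∀ {t k f} → Pos (node t k f)
  there : ∀ {t k f} (i : Fin k) → Pos (f i) → Pos (node t k f)

-- Leaves of a tree that have a parent (i.e. all leaves unless the tree is a single leaf).
data LPos : Cotree → Set where
  child  : ∀ {t k f} (i : Fin k) → IsLeaf (f i) → LPos (node t k f)
  deeper : ∀ {t k f} (i : Fin k) → LPos (f i) → LPos (node t k f)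

typeAt : ∀ {T} → Pos T → Ty
typeAt {node t _ _} here = t
typeAt (there i p) = typeAt p

parent : ∀ {T} → LPos T → Pos T
parent (child i _) = here
parent (deeper i l) = there i (parent l)

lca : ∀ {T} → Pos T → Pos T → Pos T
lca here q = here
lca (there i p) here = here
lca (there i p) (there i' q) with i FinP.≟ i'
... | yes refl = there i (lca p q)
... | no _ = here

_≟P_ : ∀ {T} (p q : Pos T) → Dec (p ≡ q)
here ≟P here = yes refl
here ≟P there _ _ = no λ ()
there _ _ ≟P here = no λ ()
there i p ≟P there i' q with i FinP.≟ i'
... | no ne = no λ { refl → ne refl }
... | yes refl with p ≟P q
...   | yes refl = yes refl
...   | no ne = no λ { refl → ne refl }

isLeaf? : (T : Cotree) → Dec (IsLeaf T)
isLeaf? leaf = yes _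
isLeaf? (node _ _ _) = no λ ()

allPos : (T : Cotree) → List (Pos T)
allPos leaf = []
allPos (node t k f) = here ∷ concatMap (λ i → map (there i) (allPos (f i))) (allFinL k)

leafChildren : ∀ {t k f} → (i : Fin k) → Dec (IsLeaf (f i)) → List (LPos (node t k f))
leafChildren i (yes l) = child i l ∷ []
leafChildren i (no _) = []

allLPos : (T : Cotree) → List (LPos T)
allLPos leaf = []
allLPos (node t k f) =
  concatMap (λ i → leafChildren i (isLeaf? (f i)) ++ map (deeper i) (allLPos (f i))) (allFinL k)

order : Cotree → ℕ
order leaf = 1
order (node t k f) = sum (map (λ i → order (f i)) (allFinL k))

countLeafChildren : Cotree → ℕ
countLeafChildren leaf = 0
countLeafChildren (node t k f) = sum (map (λ i → leafInd (f i)) (allFinL k))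
  where
  leafInd : Cotree → ℕ
  leafInd leaf = 1
  leafInd (node _ _ _) = 0

subtree : ∀ {T} → Pos T → Cotree
subtree {T} here = T
subtree (there i p) = subtree p

tcount : ∀ {T} → Pos T → ℕ
tcount p = countLeafChildren (subtree p)

[⊗] : Ty → ℕ
[⊗] ⊗ty = 1
[⊗] ∪ty = 0

δ : (T : Cotree) → (LPos T → ℕ) → Pos T → ℕ
δ T p w = sum (map (λ v → [⊗] (typeAt (lca (parent v) w)) * p v) (allLPos T))

offSum : (T : Cotree) → Pos T → ℕ
offSum T j = sum (map term (allPos T))
  where
  term : Pos T → ℕ
  term i with i ≟P j
  ... | yes _ = 0
  ... | no _ = [⊗] (typeAt (lca i j)) * tcount i

-- Cotree of the complement: switch the type of every interior vertex.
comp : Cotree → Cotree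
comp leaf = leaf
comp (node t k f) = node (swapTy t) k (λ i → comp (f i))

compPos : ∀ {T} → Pos T → Pos (comp T)
compPos here = here
compPos (there i p) = there i (compPos p)

-- Grouping the leaves of the cotree by their parents turns δ(w_j) into
-- Σ_i [lca(w_i,w_j) is ⊗] · t_i over all interior vertices w_i.  Splitting off
-- the term i = j, where lca(w_j,w_j) = w_j, gives the first formula.  In the
-- complement every lca keeps its position but switches type, so the two
-- indicators add up to 1 and δ(w_j) + δ(w̄_j) = Σ_i t_i, which counts every
-- leaf once through its parent.
module Submission where

open import Defs
open import Data.Nat using (ℕ; _+_)
open import Data.Product using (_×_)
open import Relation.Binary.PropositionalEquality using (_≡_)

open import Data.Nat using (suc; _*_)
open import Data.Nat.Properties
  using (+-identityʳ; *-identityˡ; *-identityʳ; *-zeroʳ; *-distribˡ-+; *-distribʳ-+; +-commutativeSemigroup)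
open import Algebra.Properties.CommutativeSemigroup +-commutativeSemigroup using (interchange)
open import Data.Nat.ListAction using (sum)
open import Data.Nat.ListAction.Properties using (sum-++)
open import Data.Fin using (Fin) renaming (zero to fzero; suc to fsuc)
import Data.Fin.Properties as FinP
open import Data.List using (List; []; _∷_; map; concatMap; _++_) renaming (allFin to allFinL)
open import Data.List.Properties using (map-++; map-∘; map-cong; map-tabulate)
open import Data.Product using (_,_)
open import Data.Empty using (⊥-elim)
open import Function using (_∘_; id)
open import Relation.Binary.PropositionalEquality
  using (refl; sym; trans; cong; cong₂; _≢_; module ≡-Reasoning)
open import Relation.Nullary using (Dec; yes; no; ¬_)

open ≡-Reasoning

private variable
  A B : Set

sumMap : (A → ℕ) → List A → ℕ
sumMap h xs = sum (map h xs)

sumMap-cong : {g h : A → ℕ} → (∀ x → g x ≡ h x) → ∀ xs → sumMap g xs ≡ sumMap h xs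
sumMap-cong g≗h xs = cong sum (map-cong g≗h xs)

sumMap-++ : ∀ (h : A → ℕ) xs ys → sumMap h (xs ++ ys) ≡ sumMap h xs + sumMap h ys
sumMap-++ h xs ys = trans (cong sum (map-++ h xs ys)) (sum-++ (map h xs) (map h ys))

sumMap-map : (h : B → ℕ) (g : A → B) (xs : List A) → sumMap h (map g xs) ≡ sumMap (h ∘ g) xs
sumMap-map h g xs = cong sum (sym (map-∘ xs))

sumMap-concatMap : (h : B → ℕ) (g : A → List B) (xs : List A) →
  sumMap h (concatMap g xs) ≡ sumMap (λ x → sumMap h (g x)) xs
sumMap-concatMap h g [] = refl
sumMap-concatMap h g (x ∷ xs) =
  trans (sumMap-++ h (g x) (concatMap g xs)) (cong (sumMap h (g x) +_) (sumMap-concatMap h g xs))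

sumMap-+ : ∀ (g h : A → ℕ) xs → sumMap (λ x → g x + h x) xs ≡ sumMap g xs + sumMap h xs
sumMap-+ g h [] = refl
sumMap-+ g h (x ∷ xs) =
  trans (cong (g x + h x +_) (sumMap-+ g h xs)) (interchange (g x) (h x) (sumMap g xs) (sumMap h xs))

sumMap-*ˡ : ∀ c (h : A → ℕ) xs → sumMap (λ x → c * h x) xs ≡ c * sumMap h xs
sumMap-*ˡ c h [] = sym (*-zeroʳ c)
sumMap-*ˡ c h (x ∷ xs) =
  trans (cong (c * h x +_) (sumMap-*ˡ c h xs)) (sym (*-distribˡ-+ c (h x) (sumMap h xs)))

sumMap-zero : {h : A → ℕ} → (∀ x → h x ≡ 0) → ∀ xs → sumMap h xs ≡ 0
sumMap-zero h≗0 [] = refl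
sumMap-zero h≗0 (x ∷ xs) = cong₂ _+_ (h≗0 x) (sumMap-zero h≗0 xs)

sumMap-allFin-suc : ∀ k (h : Fin (suc k) → ℕ) →
  sumMap h (allFinL (suc k)) ≡ h fzero + sumMap (h ∘ fsuc) (allFinL k)
sumMap-allFin-suc k h =
  cong (λ xs → h fzero + sum xs) (trans (map-tabulate fsuc h) (sym (map-tabulate id (h ∘ fsuc))))

sumMap-allFin-single : ∀ k (h : Fin k → ℕ) (i₀ : Fin k) →
  (∀ i → i ≢ i₀ → h i ≡ 0) → sumMap h (allFinL k) ≡ h i₀
sumMap-allFin-single (suc k) h fzero h≡0 = begin
  sumMap h (allFinL (suc k))               ≡⟨ sumMap-allFin-suc k h ⟩
  h fzero + sumMap (h ∘ fsuc) (allFinL k)  ≡⟨ cong (h fzero +_) (sumMap-zero (λ i → h≡0 (fsuc i) λ ()) (allFinL k)) ⟩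
  h fzero + 0                              ≡⟨ +-identityʳ (h fzero) ⟩
  h fzero                                  ∎
sumMap-allFin-single (suc k) h (fsuc i₀) h≡0 = begin
  sumMap h (allFinL (suc k))               ≡⟨ sumMap-allFin-suc k h ⟩
  h fzero + sumMap (h ∘ fsuc) (allFinL k)  ≡⟨ cong (_+ sumMap (h ∘ fsuc) (allFinL k)) (h≡0 fzero λ ()) ⟩
  sumMap (h ∘ fsuc) (allFinL k)            ≡⟨ sumMap-allFin-single k (h ∘ fsuc) i₀ suc≢ ⟩
  h (fsuc i₀)                              ∎
  where
  suc≢ : ∀ i → i ≢ i₀ → h (fsuc i) ≡ 0
  suc≢ i i≢i₀ = h≡0 (fsuc i) (i≢i₀ ∘ FinP.suc-injective)

ifYes : {X : Set} → Dec X → ℕ → ℕ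
ifYes (yes _) x = x
ifYes (no _)  _ = 0

ifNo : {X : Set} → Dec X → ℕ → ℕ
ifNo (yes _) _ = 0
ifNo (no _)  x = x

ifYes+ifNo : {X : Set} (d : Dec X) (x : ℕ) → ifYes d x + ifNo d x ≡ x
ifYes+ifNo (yes _) x = +-identityʳ x
ifYes+ifNo (no _)  x = refl

ifYes-⇔ : {X Y : Set} (d : Dec X) (e : Dec Y) → (X → Y) → (Y → X) → ∀ x → ifYes d x ≡ ifYes e x
ifYes-⇔ (yes _) (yes _) _  _  x = refl
ifYes-⇔ (yes p) (no ¬q) to _  x = ⊥-elim (¬q (to p))
ifYes-⇔ (no ¬p) (yes q) _ from x = ⊥-elim (¬p (from q))
ifYes-⇔ (no _)  (no _)  _  _  x = refl

ifYes-no : {X : Set} (d : Dec X) → ¬ X → ∀ x → ifYes d x ≡ 0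
ifYes-no (yes p) ¬p x = ⊥-elim (¬p p)
ifYes-no (no _)  _  x = refl

module _ {t : Ty} {k : ℕ} {f : Fin k → Cotree} where

  sumMap-allPos-node : (g : Pos (node t k f) → ℕ) →
    sumMap g (allPos (node t k f)) ≡ g here + sumMap (λ i → sumMap (g ∘ there i) (allPos (f i))) (allFinL k)
  sumMap-allPos-node g = cong (g here +_) (trans
    (sumMap-concatMap g (λ i → map (there i) (allPos (f i))) (allFinL k))
    (sumMap-cong (λ i → sumMap-map g (there i) (allPos (f i))) (allFinL k)))

  sumMap-allLPos-node : (g : LPos (node t k f) → ℕ) →
    sumMap g (allLPos (node t k f))
      ≡ sumMap (λ i → sumMap g (leafChildren i (isLeaf? (f i))) + sumMap (g ∘ deeper i) (allLPos (f i))) (allFinL k)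
  sumMap-allLPos-node g = trans
    (sumMap-concatMap g (λ i → leafChildren i (isLeaf? (f i)) ++ map (deeper i) (allLPos (f i))) (allFinL k))
    (sumMap-cong (λ i → trans (sumMap-++ g (leafChildren i (isLeaf? (f i))) (map (deeper i) (allLPos (f i))))
                         (cong (sumMap g (leafChildren i (isLeaf? (f i))) +_) (sumMap-map g (deeper i) (allLPos (f i)))))
      (allFinL k))

  sumMap-leafChildren : (h : Pos (node t k f) → ℕ) (i : Fin k) (d : Dec (IsLeaf (f i))) →
    sumMap (h ∘ parent) (leafChildren i d) ≡ h here * ifYes d 1
  sumMap-leafChildren h i (yes _) = trans (+-identityʳ (h here)) (sym (*-identityʳ (h here)))
  sumMap-leafChildren h i (no _)  = sym (*-zeroʳ (h here))

  countLeafChildren-node : countLeafChildren (node t k f) ≡ sumMap (λ i → ifYes (isLeaf? (f i)) 1) (allFinL k)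
  countLeafChildren-node = proof
    where
    -- the left-hand side is the private leaf indicator of countLeafChildren, fixed by `proof` below
    leafIndicator : (i : Fin k) → _ ≡ ifYes (isLeaf? (f i)) 1
    proof : countLeafChildren (node t k f) ≡ sumMap (λ i → ifYes (isLeaf? (f i)) 1) (allFinL k)
    proof = sumMap-cong leafIndicator (allFinL k)
    leafIndicator i with f i
    ... | leaf       = refl
    ... | node _ _ _ = refl

sumMap-parent : ∀ T (h : Pos T → ℕ) →
  sumMap (h ∘ parent) (allLPos T) ≡ sumMap (λ w → h w * tcount w) (allPos T)
sumMap-parent leaf h = refl
sumMap-parent (node t k f) h = begin
  sumMap (h ∘ parent) (allLPos (node t k f))
    ≡⟨ sumMap-allLPos-node (h ∘ parent) ⟩
  sumMap (λ i → sumMap (h ∘ parent) (leafChildren i (isLeaf? (f i)))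
              + sumMap (h ∘ parent ∘ deeper i) (allLPos (f i))) (allFinL k)
    ≡⟨ sumMap-cong (λ i → cong₂ _+_ (sumMap-leafChildren h i (isLeaf? (f i))) (sumMap-parent (f i) (h ∘ there i)))
         (allFinL k) ⟩
  sumMap (λ i → h here * ifYes (isLeaf? (f i)) 1 + below i) (allFinL k)
    ≡⟨ sumMap-+ (λ i → h here * ifYes (isLeaf? (f i)) 1) below (allFinL k) ⟩
  sumMap (λ i → h here * ifYes (isLeaf? (f i)) 1) (allFinL k) + sumMap below (allFinL k)
    ≡⟨ cong (_+ sumMap below (allFinL k)) (trans (sumMap-*ˡ (h here) (λ i → ifYes (isLeaf? (f i)) 1) (allFinL k))
         (cong (h here *_) (sym (countLeafChildren-node {t} {k} {f})))) ⟩
  h here * tcount {node t k f} here + sumMap below (allFinL k)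
    ≡⟨ sym (sumMap-allPos-node (λ w → h w * tcount w)) ⟩
  sumMap (λ w → h w * tcount w) (allPos (node t k f)) ∎
  where
  below : Fin k → ℕ
  below i = sumMap (λ w → h (there i w) * tcount w) (allPos (f i))

there-injective : ∀ {t k f} {i : Fin k} {p q : Pos (f i)} → there {t} {k} {f} i p ≡ there i q → p ≡ q
there-injective refl = refl

there-index-injective : ∀ {t k f} {i i′ : Fin k} {p : Pos (f i)} {q : Pos (f i′)} →
  there {t} {k} {f} i p ≡ there i′ q → i ≡ i′
there-index-injective refl = refl

sumMap-ifYes-≟P : ∀ T (j : Pos T) (g : Pos T → ℕ) → sumMap (λ i → ifYes (i ≟P j) (g i)) (allPos T) ≡ g j
sumMap-ifYes-≟P (node t k f) here g = begin
  sumMap (λ i → ifYes (i ≟P here) (g i)) (allPos (node t k f))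
    ≡⟨ sumMap-allPos-node (λ i → ifYes (i ≟P here) (g i)) ⟩
  g here + sumMap (λ i → sumMap (λ _ → 0) (allPos (f i))) (allFinL k)
    ≡⟨ cong (g here +_) (sumMap-zero (λ i → sumMap-zero (λ _ → refl) (allPos (f i))) (allFinL k)) ⟩
  g here + 0
    ≡⟨ +-identityʳ (g here) ⟩
  g here ∎
sumMap-ifYes-≟P (node t k f) (there i₀ q) g = begin
  sumMap (λ i → ifYes (i ≟P j) (g i)) (allPos (node t k f))
    ≡⟨ sumMap-allPos-node (λ i → ifYes (i ≟P j) (g i)) ⟩
  sumMap inSubtree (allFinL k)
    ≡⟨ sumMap-allFin-single k inSubtree i₀ otherSubtree ⟩
  sumMap (λ p → ifYes (there i₀ p ≟P j) (g (there i₀ p))) (allPos (f i₀))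
    ≡⟨ sumMap-cong (λ p → ifYes-⇔ (there i₀ p ≟P j) (p ≟P q) there-injective (cong (there i₀)) (g (there i₀ p)))
         (allPos (f i₀)) ⟩
  sumMap (λ p → ifYes (p ≟P q) (g (there i₀ p))) (allPos (f i₀))
    ≡⟨ sumMap-ifYes-≟P (f i₀) q (g ∘ there i₀) ⟩
  g j ∎
  where
  j : Pos (node t k f)
  j = there i₀ q
  inSubtree : Fin k → ℕ
  inSubtree i = sumMap (λ p → ifYes (there i p ≟P j) (g (there i p))) (allPos (f i))
  otherSubtree : ∀ i → i ≢ i₀ → inSubtree i ≡ 0
  otherSubtree i i≢i₀ =
    sumMap-zero (λ p → ifYes-no (there i p ≟P j) (i≢i₀ ∘ there-index-injective) (g (there i p))) (allPos (f i))

sumMap-allPos-split : ∀ T (j : Pos T) (g : Pos T → ℕ) →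
  sumMap g (allPos T) ≡ g j + sumMap (λ i → ifNo (i ≟P j) (g i)) (allPos T)
sumMap-allPos-split T j g = begin
  sumMap g (allPos T)
    ≡⟨ sumMap-cong (λ i → sym (ifYes+ifNo (i ≟P j) (g i))) (allPos T) ⟩
  sumMap (λ i → ifYes (i ≟P j) (g i) + ifNo (i ≟P j) (g i)) (allPos T)
    ≡⟨ sumMap-+ (λ i → ifYes (i ≟P j) (g i)) (λ i → ifNo (i ≟P j) (g i)) (allPos T) ⟩
  sumMap (λ i → ifYes (i ≟P j) (g i)) (allPos T) + sumMap (λ i → ifNo (i ≟P j) (g i)) (allPos T)
    ≡⟨ cong (_+ sumMap (λ i → ifNo (i ≟P j) (g i)) (allPos T)) (sumMap-ifYes-≟P T j g) ⟩
  g j + sumMap (λ i → ifNo (i ≟P j) (g i)) (allPos T) ∎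

lca-idem : ∀ {T} (p : Pos T) → lca p p ≡ p
lca-idem here = refl
lca-idem (there i p) with i FinP.≟ i
... | yes refl = cong (there i) (lca-idem p)
... | no i≢i = ⊥-elim (i≢i refl)

⊗-weight : ∀ {T} → Pos T → Pos T → ℕ
⊗-weight j i = [⊗] (typeAt (lca i j)) * tcount i

δ-unit-as-sum : ∀ T (j : Pos T) → δ T (λ _ → 1) j ≡ sumMap (⊗-weight j) (allPos T)
δ-unit-as-sum T j = trans (sumMap-cong (λ v → *-identityʳ _) (allLPos T)) (sumMap-parent T (λ i → [⊗] (typeAt (lca i j))))

offSum-as-sum : ∀ T (j : Pos T) → offSum T j ≡ sumMap (λ i → ifNo (i ≟P j) (⊗-weight j i)) (allPos T)
offSum-as-sum T j = proof
  where
  term≡ : (i : Pos T) → _ ≡ ifNo (i ≟P j) (⊗-weight j i)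
  proof : offSum T j ≡ sumMap (λ i → ifNo (i ≟P j) (⊗-weight j i)) (allPos T)
  proof = sumMap-cong term≡ (allPos T)
  term≡ i with i ≟P j
  ... | yes _ = refl
  ... | no _  = refl

δ-unit-split : ∀ T (j : Pos T) → δ T (λ _ → 1) j ≡ [⊗] (typeAt j) * tcount j + offSum T j
δ-unit-split T j = begin
  δ T (λ _ → 1) j                         ≡⟨ δ-unit-as-sum T j ⟩
  sumMap (⊗-weight j) (allPos T)          ≡⟨ sumMap-allPos-split T j (⊗-weight j) ⟩
  ⊗-weight j j + sumMap (λ i → ifNo (i ≟P j) (⊗-weight j i)) (allPos T)
    ≡⟨ cong₂ _+_ (cong (λ w → [⊗] (typeAt w) * tcount j) (lca-idem j)) (sym (offSum-as-sum T j)) ⟩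
  [⊗] (typeAt j) * tcount j + offSum T j  ∎

sumMap-allPos-comp : ∀ T (h : Pos (comp T) → ℕ) → sumMap h (allPos (comp T)) ≡ sumMap (h ∘ compPos) (allPos T)
sumMap-allPos-comp leaf h = refl
sumMap-allPos-comp (node t k f) h = begin
  sumMap h (allPos (comp (node t k f)))
    ≡⟨ sumMap-allPos-node h ⟩
  h here + sumMap (λ i → sumMap (h ∘ there i) (allPos (comp (f i)))) (allFinL k)
    ≡⟨ cong (h here +_) (sumMap-cong (λ i → sumMap-allPos-comp (f i) (h ∘ there i)) (allFinL k)) ⟩
  h here + sumMap (λ i → sumMap (h ∘ compPos ∘ there i) (allPos (f i))) (allFinL k)
    ≡⟨ sym (sumMap-allPos-node (h ∘ compPos)) ⟩
  sumMap (h ∘ compPos) (allPos (node t k f)) ∎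

ifYes-isLeaf?-comp : ∀ T → ifYes (isLeaf? (comp T)) 1 ≡ ifYes (isLeaf? T) 1
ifYes-isLeaf?-comp leaf         = refl
ifYes-isLeaf?-comp (node _ _ _) = refl

countLeafChildren-comp : ∀ T → countLeafChildren (comp T) ≡ countLeafChildren T
countLeafChildren-comp leaf = refl
countLeafChildren-comp (node t k f) = begin
  countLeafChildren (comp (node t k f))
    ≡⟨ countLeafChildren-node {swapTy t} {k} {comp ∘ f} ⟩
  sumMap (λ i → ifYes (isLeaf? (comp (f i))) 1) (allFinL k)
    ≡⟨ sumMap-cong (ifYes-isLeaf?-comp ∘ f) (allFinL k) ⟩
  sumMap (λ i → ifYes (isLeaf? (f i)) 1) (allFinL k)
    ≡⟨ sym (countLeafChildren-node {t} {k} {f}) ⟩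
  countLeafChildren (node t k f) ∎

subtree-compPos : ∀ {T} (p : Pos T) → subtree (compPos p) ≡ comp (subtree p)
subtree-compPos here        = refl
subtree-compPos (there i p) = subtree-compPos p

tcount-compPos : ∀ {T} (p : Pos T) → tcount (compPos p) ≡ tcount p
tcount-compPos p = trans (cong countLeafChildren (subtree-compPos p)) (countLeafChildren-comp (subtree p))

lca-compPos : ∀ {T} (p q : Pos T) → lca (compPos p) (compPos q) ≡ compPos (lca p q)
lca-compPos here        q            = refl
lca-compPos (there i p) here         = refl
lca-compPos (there i p) (there i′ q) with i FinP.≟ i′
... | yes refl = cong (there i) (lca-compPos p q)
... | no _     = refl

typeAt-compPos : ∀ {T} (p : Pos T) → typeAt (compPos p) ≡ swapTy (typeAt p)
typeAt-compPos {node t k f} here = refl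
typeAt-compPos (there i p)       = typeAt-compPos p

[⊗]+[⊗]-swapTy : ∀ t → [⊗] t + [⊗] (swapTy t) ≡ 1
[⊗]+[⊗]-swapTy ∪ty = refl
[⊗]+[⊗]-swapTy ⊗ty = refl

⊗-weight-comp : ∀ {T} (j i : Pos T) → ⊗-weight j i + ⊗-weight (compPos j) (compPos i) ≡ tcount i
⊗-weight-comp j i = begin
  [⊗] (typeAt (lca i j)) * tcount i + [⊗] (typeAt (lca (compPos i) (compPos j))) * tcount (compPos i)
    ≡⟨ cong₂ (λ t n → [⊗] (typeAt (lca i j)) * tcount i + [⊗] t * n)
         (trans (cong typeAt (lca-compPos i j)) (typeAt-compPos (lca i j))) (tcount-compPos i) ⟩
  [⊗] (typeAt (lca i j)) * tcount i + [⊗] (swapTy (typeAt (lca i j))) * tcount i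
    ≡⟨ sym (*-distribʳ-+ (tcount i) ([⊗] (typeAt (lca i j))) _) ⟩
  ([⊗] (typeAt (lca i j)) + [⊗] (swapTy (typeAt (lca i j)))) * tcount i
    ≡⟨ cong (_* tcount i) ([⊗]+[⊗]-swapTy (typeAt (lca i j))) ⟩
  1 * tcount i
    ≡⟨ *-identityˡ (tcount i) ⟩
  tcount i ∎

order-as-sum : ∀ T → order T ≡ ifYes (isLeaf? T) 1 + sumMap tcount (allPos T)
order-as-sum leaf = refl
order-as-sum (node t k f) = begin
  sumMap (order ∘ f) (allFinL k)
    ≡⟨ sumMap-cong (order-as-sum ∘ f) (allFinL k) ⟩
  sumMap (λ i → ifYes (isLeaf? (f i)) 1 + sumMap tcount (allPos (f i))) (allFinL k)
    ≡⟨ sumMap-+ (λ i → ifYes (isLeaf? (f i)) 1) (λ i → sumMap tcount (allPos (f i))) (allFinL k) ⟩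
  sumMap (λ i → ifYes (isLeaf? (f i)) 1) (allFinL k) + sumMap (λ i → sumMap tcount (allPos (f i))) (allFinL k)
    ≡⟨ cong (_+ _) (sym (countLeafChildren-node {t} {k} {f})) ⟩
  tcount {node t k f} here + sumMap (λ i → sumMap tcount (allPos (f i))) (allFinL k)
    ≡⟨ sym (sumMap-allPos-node {t} {k} {f} tcount) ⟩
  sumMap tcount (allPos (node t k f)) ∎

order≡δ+δ-comp : ∀ T (j : Pos T) → order T ≡ δ T (λ _ → 1) j + δ (comp T) (λ _ → 1) (compPos j)
order≡δ+δ-comp (node t k f) j = begin
  order T
    ≡⟨ order-as-sum T ⟩
  sumMap tcount (allPos T)
    ≡⟨ sym (sumMap-cong (⊗-weight-comp j) (allPos T)) ⟩
  sumMap (λ i → ⊗-weight j i + ⊗-weight (compPos j) (compPos i)) (allPos T)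
    ≡⟨ sumMap-+ (⊗-weight j) (⊗-weight (compPos j) ∘ compPos) (allPos T) ⟩
  sumMap (⊗-weight j) (allPos T) + sumMap (⊗-weight (compPos j) ∘ compPos) (allPos T)
    ≡⟨ cong₂ _+_ (sym (δ-unit-as-sum T j))
         (trans (sym (sumMap-allPos-comp T (⊗-weight (compPos j)))) (sym (δ-unit-as-sum (comp T) (compPos j)))) ⟩
  δ T (λ _ → 1) j + δ (comp T) (λ _ → 1) (compPos j) ∎
  where
  T : Cotree
  T = node t k f

proposition3p1 : (T : Cotree) → WF T → (j : Pos T) →
    ((typeAt j ≡ ⊗ty → δ T (λ _ → 1) j ≡ tcount j + offSum T j)
    × (typeAt j ≡ ∪ty → δ T (λ _ → 1) j ≡ offSum T j))
    × (order T ≡ δ T (λ _ → 1) j + δ (comp T) (λ _ → 1) (compPos j))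
proposition3p1 T _ j = (⊗-case , ∪-case) , order≡δ+δ-comp T j
  where
  ⊗-case : typeAt j ≡ ⊗ty → δ T (λ _ → 1) j ≡ tcount j + offSum T j
  ⊗-case j⊗ = begin
    δ T (λ _ → 1) j                         ≡⟨ δ-unit-split T j ⟩
    [⊗] (typeAt j) * tcount j + offSum T j  ≡⟨ cong (λ t → [⊗] t * tcount j + offSum T j) j⊗ ⟩
    tcount j + 0 + offSum T j               ≡⟨ cong (_+ offSum T j) (+-identityʳ (tcount j)) ⟩
    tcount j + offSum T j                   ∎
  ∪-case : typeAt j ≡ ∪ty → δ T (λ _ → 1) j ≡ offSum T j
  ∪-case j∪ = trans (δ-unit-split T j) (cong (λ t → [⊗] t * tcount j + offSum T j) j∪)
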